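{- Let $\mathbb P,\mathbb Q,\mathbb R$ be perfect-tree forcing notions. (i) If $\mathbb P\sqsubset\!\sqsubset\mathbb Q$ and $S\in\mathbb P$, $T\in\mathbb Q$, then $[S]\cap[T]$ is meager in $[S]$; therefore $\mathbb P\cap\mathbb Q=\emptyset$ and $\mathbb Q$ is open dense in $\mathbb P\cup\mathbb Q$. (ii) If $\mathbb P\sqsubset\!\sqsubset\mathbb Q\sqsubset\!\sqsubset\mathbb R$ then $\mathbb P\sqsubset\!\sqsubset\mathbb R$; thus $\sqsubset\!\sqsubset$ is a strict partial order. (iii) If $\langle\mathbb P_\alpha:\alpha<\lambda\rangle$ is a $\sqsubset\!\sqsubset$-increasing sequence of perfect-tree forcing notions and $0<\mu<\lambda$, then $\bigcup_{\alpha<\mu}\mathbb P_\alpha\sqsubset\!\sqsubset\bigcup_{\mu\le\alpha<\lambda}\mathbb P_\alpha$. (iv) If $\langle\mathbb P_\alpha:\alpha<\lambda\rangle$ is a $\sqsubset\!\sqsubset$-increasing sequence of special perfect-tree forcing notions, then $\mathbb P=\bigcup_{\alpha<\lambda}\mathbb P_\alpha$ is a regular perfect-tree forcing notion, and each $\mathbb P_\gamma$ ($\gamma<\lambda$) is pre-dense in $\mathbb P$.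
   Context: $2^{<\omega}$ is the set of finite binary strings. A perfect tree is a non-empty $T\subseteq 2^{<\omega}$ closed under initial segments with no endpoints and no isolated branches; $[T]\subseteq 2^\omega$ is its set of branches; for $s\in T$, $T\restriction s=\{t\in T:s\subseteq t\lor t\subseteq s\}$. Trees $S,T$ are almost disjoint if $[S]\cap[T]=\emptyset$. A perfect-tree forcing notion is a non-empty set $\mathbb P$ of perfect trees with $T\restriction s\in\mathbb P$ whenever $s\in T\in\mathbb P$; it is ordered by inclusion (smaller = stronger), and open, dense, pre-dense subsets are understood with respect to this order. $\mathbb P$ is special if there is a set $A\subseteq\mathbb P$ of pairwise almost disjoint trees with $\mathbb P=\{T\restriction s:s\in T\in A\}$; $\mathbb P$ is regular if for all $S,T\in\mathbb P$, $[S]\cap[T]$ is clopen in $[S]$ or in $[T]$. For a perfect tree $Q$ and a set $D$ of perfect trees, $Q\subseteq^{\mathrm{fin}}\bigcup D$ means there is a finite $D'\subseteq D$ with $[Q]\subseteq\bigcup_{S\in D'}[S]$. For perfect-tree forcing notions $\mathbb P,\mathbb Q$, $\mathbb P\sqsubset\!\sqsubset\mathbb Q$ ($\mathbb Q$ refines $\mathbb P$) means: (1) for every $T\in\mathbb P$ there is $Q\in\mathbb Q$ with $Q\subseteq T$; (2) every $Q\in\mathbb Q$ satisfies $Q\subseteq^{\mathrm{fin}}\bigcup\mathbb P$; (3) if $Q\in\mathbb Q$ and $T\in\mathbb P$ then $[Q]\cap[T]$ is clopen in $[Q]$ and $T\not\subseteq Q$. A sequence is $\sqsubset\!\sqsubset$-increasing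 if $\mathbb P_\alpha\sqsubset\!\sqsubset\mathbb P_\beta$ whenever $\alpha<\beta$. -}

module Defs where

open import Level using (Level; 0ℓ) renaming (suc to lsuc)
open import Data.Bool using (Bool; true; false)
open import Data.Nat using (ℕ)
open import Data.List using (List; []; _∷_; _++_; [_])
open import Data.List.Relation.Unary.All using (All)
open import Data.List.Relation.Unary.Any using (Any)
open import Data.Product using (Σ; ∃; ∃-syntax; _×_; _,_)
open import Data.Sum using (_⊎_)
open import Data.Empty using (⊥)
open import Relation.Nullary using (¬_)
open import Relation.Binary.PropositionalEquality using (_≡_)
open import Relation.Binary.Core using (Rel)
open import Relation.Binary.Structures using (IsStrictTotalOrder)
open import Induction.WellFounded using (WellFounded)

Str : Set
Str = List Bool

Cantor : Set
Cantor = ℕ → Bool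

_⊑_ : Str → Str → Set
s ⊑ t = ∃[ u ] (s ++ u ≡ t)

_↾_ : Cantor → ℕ → Str
x ↾ ℕ.zero = []
x ↾ ℕ.suc n = x ℕ.zero ∷ ((λ k → x (ℕ.suc k)) ↾ n)

_≺_ : Str → Cantor → Set
s ≺ x = ∃[ n ] (x ↾ n ≡ s)

Tree : Set₁
Tree = Str → Set

_⊆ᵀ_ : Tree → Tree → Set
S ⊆ᵀ T = ∀ s → S s → T s

_≐_ : Tree → Tree → Set
S ≐ T = S ⊆ᵀ T × T ⊆ᵀ S

_∣_ : Tree → Str → Tree
(T ∣ s) t = T t × (s ⊑ t ⊎ t ⊑ s)

record IsPerfect (T : Tree) : Set where
  field
    nonempty  : T []
    prefixClosed : ∀ {s t} → s ⊑ t → T t → T s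
    noEndpoints  : ∀ {s} → T s → ∃[ b ] T (s ++ [ b ])
    splitting    : ∀ {s} → T s → ∃[ t ] (s ⊑ t × T (t ++ [ true ]) × T (t ++ [ false ]))

CSet : Set₁
CSet = Cantor → Set

⟦_⟧ : Tree → CSet
⟦ T ⟧ x = ∀ n → T (x ↾ n)

_∩_ : CSet → CSet → CSet
(A ∩ B) x = A x × B x

OpenIn : CSet → CSet → Set
OpenIn X U = ∀ x → X x → U x → ∃[ n ] (∀ y → X y → y ↾ n ≡ x ↾ n → U y)

ClopenIn : CSet → CSet → Set
ClopenIn X A = OpenIn X A × OpenIn X (λ y → ¬ A y)

NowhereDenseIn : CSet → CSet → Set
NowhereDenseIn X A =
  ∀ s → (Σ Cantor λ x → (X x × s ≺ x)) →
  ∃[ t ] (s ⊑ t × (Σ Cantor λ x → (X x × t ≺ x)) × (∀ y → X y → t ≺ y → ¬ A y))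

MeagerIn : CSet → CSet → Set₁
MeagerIn X A = Σ (ℕ → CSet) λ N → ((∀ (k : ℕ) → NowhereDenseIn X (N k)) ×
                       (∀ x → X x → A x → Σ ℕ λ k → N k x))

TSet : Set₁
TSet = Tree → Set

record IsPTF (P : TSet) : Set₁ where
  field
    inhabited   : ∃[ T ] P T
    perfect     : ∀ {T} → P T → IsPerfect T
    restrict    : ∀ {T s} → P T → T s → P (T ∣ s)
    -- convention: sets of trees are extensional
    extensional : ∀ {S T} → S ≐ T → P S → P T

_∪ᵀ_ : TSet → TSet → TSet
(P ∪ᵀ Q) T = P T ⊎ Q T

Disjoint : TSet → TSet → Set₁
Disjoint P Q = ∀ T → P T → Q T → ⊥

-- forcing order inside a set ℙ of trees: smaller = stronger
OpenInP : TSet → TSet → Set₁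
OpenInP ℙ D = ∀ T → D T → ∀ T' → ℙ T' → T' ⊆ᵀ T → D T'

DenseInP : TSet → TSet → Set₁
DenseInP ℙ D = ∀ T → ℙ T → ∃[ T' ] (D T' × T' ⊆ᵀ T)

PreDenseInP : TSet → TSet → Set₁
PreDenseInP ℙ D = (∀ T → D T → ℙ T) ×
  (∀ T → ℙ T → ∃[ S ] (D S × ∃[ R ] (ℙ R × R ⊆ᵀ T × R ⊆ᵀ S)))

_⊆fin⋃_ : Tree → TSet → Set₁
Q ⊆fin⋃ D = ∃[ Ds ] (All D Ds × (∀ x → ⟦ Q ⟧ x → Any (λ S → ⟦ S ⟧ x) Ds))

_⊏⊏_ : TSet → TSet → Set₁
ℙ ⊏⊏ ℚ =
  (∀ T → ℙ T → ∃[ Q ] (ℚ Q × Q ⊆ᵀ T)) ×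
  (∀ Q → ℚ Q → Q ⊆fin⋃ ℙ) ×
  (∀ Q T → ℚ Q → ℙ T → ClopenIn ⟦ Q ⟧ (⟦ Q ⟧ ∩ ⟦ T ⟧) × ¬ (T ⊆ᵀ Q))

Special : TSet → Set₁
Special ℙ = Σ TSet λ A →
  ((∀ S T → A S → A T → ¬ (S ≐ T) → ∀ x → ⟦ S ⟧ x → ⟦ T ⟧ x → ⊥) ×
   (∀ T → ℙ T → Σ Tree λ S → Σ Str λ s → (A S × S s × T ≐ (S ∣ s))) ×
   (∀ S s → A S → S s → ℙ (S ∣ s)))

Regular : TSet → Set₁
Regular ℙ = ∀ S T → ℙ S → ℙ T →
  ClopenIn ⟦ S ⟧ (⟦ S ⟧ ∩ ⟦ T ⟧) ⊎ ClopenIn ⟦ T ⟧ (⟦ S ⟧ ∩ ⟦ T ⟧)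

-- Ordinals λ, represented as well-ordered index types (α < λ ↔ α : I)

record WellOrder : Set₁ where
  field
    Carrier : Set
    _<_     : Rel Carrier 0ℓ
    isStrictTotalOrder : IsStrictTotalOrder _≡_ _<_
    wellFounded : WellFounded _<_

Increasing : (W : WellOrder) → (WellOrder.Carrier W → TSet) → Set₁
Increasing W P = ∀ α β → α < β → P α ⊏⊏ P β
  where open WellOrder W

⋃Below : (W : WellOrder) → (WellOrder.Carrier W → TSet) → WellOrder.Carrier W → TSet
⋃Below W P μ T = ∃[ α ] (α < μ × P α T)
  where open WellOrder W

⋃From : (W : WellOrder) → (WellOrder.Carrier W → TSet) → WellOrder.Carrier W → TSet
⋃From W P μ T = ∃[ α ] (¬ (α < μ) × P α T)
  where open WellOrder W

⋃All : (W : WellOrder) → (WellOrder.Carrier W → TSet) → TSet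
⋃All W P T = ∃[ α ] P α T

module Submission where

-- The development has three layers.
--   * Strings and branches: restrictions x ↾ n, the branches of T ∣ t, and
--     the fact that through every node of a perfect tree passes a branch, so a
--     perfect tree R is contained in T as soon as [R] ⊆ [T].
--   * Topology of Cantor space: neighbourhoods, clopenness via cylinders,
--     emptiness and local covers, and (classically) that a closed set [T]
--     with empty interior in X is nowhere dense in X.
--   * Refinement: (i) clause (3) of ℙ ⊏⊏ ℚ forbids [S ∣ s] ⊆ [T] for S ∈ ℙ,
--     T ∈ ℚ, so [S] ∩ [T] has empty interior in [S] and is meager; disjointness,
--     openness and density are immediate.  (ii) Finite covers compose and
--     clopenness is local, giving transitivity.  (iii) is a reindexing of the
--     clauses of ⊏⊏.  (iv) Within one special notion two trees are restrictions
--     of equal or disjoint trees, hence meet in a clopen set; across levels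
--     clause (3) applies; and an element of a later level has a restriction
--     lying below an element of the earlier level, giving pre-density.

open import Defs
open import Level using (Level; 0ℓ)
open import Axiom.ExcludedMiddle using (ExcludedMiddle)
open import Axiom.DoubleNegationElimination using (em⇒dne)
open import Data.Product using (Σ; _×_; _,_; proj₁; proj₂; ∃-syntax; swap)
open import Data.Sum using (_⊎_; inj₁; inj₂)
open import Data.Empty using (⊥-elim)
open import Data.Nat using (zero; suc; pred; _+_; _≤_; s≤s)
open import Data.Nat.Properties using (≤-total; m≤m+n; m≤n+m; +-identityʳ)
open import Data.List using (List; []; _∷_; _++_; [_]; length)
open import Data.List.Properties using (++-identityʳ; ++-assoc; ∷-injective)
open import Data.List.Relation.Unary.All using (All; []; _∷_)
open import Data.List.Relation.Unary.Any using (Any; here; there)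
import Data.List.Relation.Unary.All as All
import Data.List.Relation.Unary.Any as Any
import Data.List.Relation.Unary.All.Properties as All
import Data.List.Relation.Unary.Any.Properties as Any
open import Relation.Nullary using (¬_; yes; no)
open import Relation.Binary.PropositionalEquality
  using (_≡_; refl; sym; trans; cong; cong₂; subst)
open import Relation.Binary.Definitions using (tri<; tri≈; tri>)
open import Relation.Binary.Structures using (IsStrictTotalOrder)

-- Excluded middle is needed only for propositions in Set.
EM : Set₁
EM = ExcludedMiddle 0ℓ

shift : Cantor → Cantor
shift x k = x (suc k)

length-↾ : ∀ x n → length (x ↾ n) ≡ n
length-↾ x zero    = refl
length-↾ x (suc n) = cong suc (length-↾ (shift x) n)

↾-⊑ : ∀ x {m n} → m ≤ n → (x ↾ m) ⊑ (x ↾ n)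
↾-⊑ x {zero}  {n}     _         = x ↾ n , refl
↾-⊑ x {suc m} {suc n} (s≤s m≤n) =
  let (u , eq) = ↾-⊑ (shift x) m≤n in u , cong (x zero ∷_) eq

↾-comparable : ∀ x m n → (x ↾ m) ⊑ (x ↾ n) ⊎ (x ↾ n) ⊑ (x ↾ m)
↾-comparable x m n with ≤-total m n
... | inj₁ m≤n = inj₁ (↾-⊑ x m≤n)
... | inj₂ n≤m = inj₂ (↾-⊑ x n≤m)

↾-agree : ∀ x y {m n} → m ≤ n → x ↾ n ≡ y ↾ n → x ↾ m ≡ y ↾ m
↾-agree x y {zero}  _         _  = refl
↾-agree x y {suc m} (s≤s m≤n) eq =
  let (head≡ , tail≡) = ∷-injective eq
  in cong₂ _∷_ head≡ (↾-agree (shift x) (shift y) m≤n tail≡)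

⊑-sameLength : ∀ {s t : Str} → s ⊑ t → length s ≡ length t → s ≡ t
⊑-sameLength {[]}    {[]}    _        _ = refl
⊑-sameLength {[]}    {_ ∷ _} _        ()
⊑-sameLength {_ ∷ _} {[]}    (_ , ()) _
⊑-sameLength {_ ∷ s} {_ ∷ t} (u , eq) l =
  let (head≡ , tail≡) = ∷-injective eq
  in cong₂ _∷_ head≡ (⊑-sameLength (u , tail≡) (cong pred l))

≺-agree : ∀ {y z m n} → (y ↾ m) ≺ z → n ≤ m → z ↾ n ≡ y ↾ n
≺-agree {y} {z} {m} (i , zi≡ym) n≤m = ↾-agree z y n≤m zm≡ym
  where
  i≡m : i ≡ m
  i≡m = trans (sym (length-↾ z i)) (trans (cong length zi≡ym) (length-↾ y m))
  zm≡ym : z ↾ m ≡ y ↾ m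
  zm≡ym = subst (λ k → z ↾ k ≡ y ↾ m) i≡m zi≡ym

⟦∣⟧→ : ∀ {T t x} → ⟦ T ∣ t ⟧ x → ⟦ T ⟧ x × x ↾ length t ≡ t
⟦∣⟧→ {T} {t} {x} x∈T∣t = (λ n → proj₁ (x∈T∣t n)) , through (proj₂ (x∈T∣t (length t)))
  where
  same : length (x ↾ length t) ≡ length t
  same = length-↾ x (length t)
  through : t ⊑ (x ↾ length t) ⊎ (x ↾ length t) ⊑ t → x ↾ length t ≡ t
  through (inj₁ t⊑) = sym (⊑-sameLength t⊑ (sym same))
  through (inj₂ ⊑t) = ⊑-sameLength ⊑t same

⟦∣⟧← : ∀ {T t x} → ⟦ T ⟧ x → x ↾ length t ≡ t → ⟦ T ∣ t ⟧ x
⟦∣⟧← {T} {t} {x} x∈T xt≡t n = x∈T n , rewrite-t (↾-comparable x (length t) n)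
  where
  rewrite-t : (x ↾ length t) ⊑ (x ↾ n) ⊎ (x ↾ n) ⊑ (x ↾ length t) →
              t ⊑ (x ↾ n) ⊎ (x ↾ n) ⊑ t
  rewrite-t (inj₁ p) = inj₁ (subst (_⊑ (x ↾ n)) xt≡t p)
  rewrite-t (inj₂ p) = inj₂ (subst ((x ↾ n) ⊑_) xt≡t p)

_⌢_ : Str → Cantor → Cantor
([]    ⌢ z) k       = z k
((b ∷ s) ⌢ z) zero  = b
((b ∷ s) ⌢ z) (suc k) = (s ⌢ z) k

⌢-↾ : ∀ s z m → (s ⌢ z) ↾ (length s + m) ≡ s ++ (z ↾ m)
⌢-↾ []      z m = refl
⌢-↾ (b ∷ s) z m = cong (b ∷_) (⌢-↾ s z m)

module _ {R : Tree} (perfect : IsPerfect R) where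
  open IsPerfect perfect

  continuation : ∀ s → R s → Cantor
  continuation s r zero    = proj₁ (noEndpoints r)
  continuation s r (suc k) =
    continuation (s ++ [ proj₁ (noEndpoints r) ]) (proj₂ (noEndpoints r)) k

  continuation-∈ : ∀ m s (r : R s) → R (s ++ (continuation s r ↾ m))
  continuation-∈ zero    s r = subst R (sym (++-identityʳ s)) r
  continuation-∈ (suc m) s r =
    subst R (++-assoc s [ proj₁ (noEndpoints r) ] _)
      (continuation-∈ m (s ++ [ proj₁ (noEndpoints r) ]) (proj₂ (noEndpoints r)))

  branchThrough : ∀ {s} → R s → Σ Cantor λ y → ⟦ R ⟧ y × y ↾ length s ≡ s
  branchThrough {s} r = y , y∈R , y↾s
    where
    z = continuation s r
    y = s ⌢ z
    y↾s : y ↾ length s ≡ s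
    y↾s = trans (cong (y ↾_) (sym (+-identityʳ (length s))))
                (trans (⌢-↾ s z 0) (++-identityʳ s))
    y∈R : ⟦ R ⟧ y
    y∈R n = prefixClosed (↾-⊑ y (m≤n+m n (length s)))
              (subst R (sym (⌢-↾ s z n)) (continuation-∈ n s r))

  ⟦⟧⊆⇒⊆ᵀ : ∀ {T : Tree} → (∀ y → ⟦ R ⟧ y → ⟦ T ⟧ y) → R ⊆ᵀ T
  ⟦⟧⊆⇒⊆ᵀ {T} [R]⊆[T] u u∈R =
    let (y , y∈R , y↾u) = branchThrough u∈R
    in subst T y↾u ([R]⊆[T] y y∈R (length u))

⟦≐⟧ : ∀ {S T} → S ≐ T → ∀ x → ⟦ S ⟧ x → ⟦ T ⟧ x
⟦≐⟧ (S⊆T , _) x x∈S n = S⊆T _ (x∈S n)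

Nbhd : CSet → CSet → Cantor → Set
Nbhd X U x = ∃[ n ] (∀ y → X y → y ↾ n ≡ x ↾ n → U y)

Nbhd-mono : ∀ {X U V : CSet} {x} → (∀ y → X y → U y → V y) → Nbhd X U x → Nbhd X V x
Nbhd-mono U⇒V (n , inU) = n , λ y y∈X agree → U⇒V y y∈X (inU y y∈X agree)

Nbhd-chain : ∀ {X Y U : CSet} {x} → Nbhd X Y x → Nbhd Y U x → Nbhd X U x
Nbhd-chain {x = x} (m , inY) (n , inU) = m + n , λ y y∈X agree →
  inU y (inY y y∈X (↾-agree y x (m≤m+n m n) agree)) (↾-agree y x (m≤n+m n m) agree)

ClopenIn-∩-comm : ∀ {X A B : CSet} → ClopenIn X (A ∩ B) → ClopenIn X (B ∩ A)
ClopenIn-∩-comm (open₁ , open₂) =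
  (λ x x∈X x∈BA → Nbhd-mono (λ _ _ → swap) (open₁ x x∈X (swap x∈BA))) ,
  (λ x x∈X x∉BA → Nbhd-mono (λ _ _ y∉AB y∈BA → y∉AB (swap y∈BA))
                    (open₂ x x∈X (λ x∈AB → x∉BA (swap x∈AB))))

ClopenIn-empty : ∀ {X A : CSet} → (∀ y → X y → ¬ A y) → ClopenIn X A
ClopenIn-empty {X} A∩X=∅ =
  (λ x x∈X x∈A → ⊥-elim (A∩X=∅ x x∈X x∈A)) ,
  (λ _ _ _ → 0 , λ y y∈X _ → A∩X=∅ y y∈X)

ClopenIn-cylinder : ∀ {X A : CSet} n (t : Str) →
  (∀ y → X y → A y → y ↾ n ≡ t) → (∀ y → X y → y ↾ n ≡ t → A y) → ClopenIn X A
ClopenIn-cylinder {X} {A} n t inside outside =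
  (λ x x∈X x∈A → n , λ y y∈X agree → outside y y∈X (trans agree (inside x x∈X x∈A))) ,
  (λ x x∈X x∉A → n , λ y y∈X agree y∈A →
     x∉A (outside x x∈X (trans (sym agree) (inside y y∈X y∈A))))

ClopenIn-local : ∀ {X A : CSet} →
  (∀ x → X x → Σ CSet λ Y → Y x × Nbhd X Y x × ClopenIn Y (Y ∩ A)) →
  ClopenIn X (X ∩ A)
ClopenIn-local {X} {A} cover = openPart , closedPart
  where
  openPart : OpenIn X (X ∩ A)
  openPart x x∈X (_ , x∈A) =
    let (Y , x∈Y , nbhdY , (openY , _)) = cover x x∈X
    in Nbhd-mono (λ y y∈X y∈A → y∈X , y∈A)
         (Nbhd-chain nbhdY (Nbhd-mono (λ _ _ → proj₂) (openY x x∈Y (x∈Y , x∈A))))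
  closedPart : OpenIn X (λ y → ¬ (X ∩ A) y)
  closedPart x x∈X x∉X∩A =
    let (Y , x∈Y , nbhdY , (_ , closedY)) = cover x x∈X
    in Nbhd-mono (λ y y∈X y∉A y∈X∩A → y∉A (proj₂ y∈X∩A))
         (Nbhd-chain nbhdY
           (Nbhd-mono (λ y y∈Y y∉Y∩A y∈A → y∉Y∩A (y∈Y , y∈A))
             (closedY x x∈Y (λ x∈Y∩A → x∉X∩A (x∈X , proj₂ x∈Y∩A)))))

-- A closed set [T] with empty interior in X is nowhere dense in X: every
-- basic open set meeting X has a point of X outside [T], and since [T] is
-- closed a whole basic neighbourhood of that point avoids [T].
closed-nowhereDense : EM → ∀ {X : CSet} (T : Tree) →
  (∀ s → (Σ Cantor λ x → X x × s ≺ x) → ¬ (∀ y → X y → s ≺ y → ⟦ T ⟧ y)) →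
  NowhereDenseIn X (X ∩ ⟦ T ⟧)
closed-nowhereDense em {X} T emptyInterior s meets =
  em⇒dne em λ noExtension →
    emptyInterior s meets λ y y∈X s≺y n →
      em⇒dne em λ y↾n∉T → noExtension (avoid y y∈X s≺y n y↾n∉T)
  where
  avoid : ∀ y → X y → s ≺ y → ∀ n → ¬ T (y ↾ n) →
    ∃[ t ] (s ⊑ t × (Σ Cantor λ x → (X x × t ≺ x)) × (∀ z → X z → t ≺ z → ¬ (X ∩ ⟦ T ⟧) z))
  avoid y y∈X (j , y↾j≡s) n y↾n∉T =
    y ↾ (j + n) ,
    subst (_⊑ (y ↾ (j + n))) y↾j≡s (↾-⊑ y (m≤m+n j n)) ,
    (y , y∈X , (j + n) , refl) ,
    λ z _ t≺z z∈X∩T → y↾n∉T (subst T (≺-agree t≺z (m≤n+m n j)) (proj₂ z∈X∩T n))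

nowhereDense⇒meager : ∀ {X A : CSet} → NowhereDenseIn X A → MeagerIn X A
nowhereDense⇒meager {A = A} nd = (λ _ → A) , (λ _ → nd) , (λ _ _ x∈A → 0 , x∈A)

module _ {ℙ ℚ : TSet} (ℙ⊏⊏ℚ : ℙ ⊏⊏ ℚ) where

  ⊏⊏-below : ∀ T → ℙ T → ∃[ Q ] (ℚ Q × Q ⊆ᵀ T)
  ⊏⊏-below = proj₁ ℙ⊏⊏ℚ

  ⊏⊏-covered : ∀ Q → ℚ Q → Q ⊆fin⋃ ℙ
  ⊏⊏-covered = proj₁ (proj₂ ℙ⊏⊏ℚ)

  ⊏⊏-clopen : ∀ Q T → ℚ Q → ℙ T → ClopenIn ⟦ Q ⟧ (⟦ Q ⟧ ∩ ⟦ T ⟧)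
  ⊏⊏-clopen Q T q t = proj₁ (proj₂ (proj₂ ℙ⊏⊏ℚ) Q T q t)

  ⊏⊏-notAbove : ∀ Q T → ℚ Q → ℙ T → ¬ (T ⊆ᵀ Q)
  ⊏⊏-notAbove Q T q t = proj₂ (proj₂ (proj₂ ℙ⊏⊏ℚ) Q T q t)

  ⊏⊏-branchCovered : ∀ {Q x} → ℚ Q → ⟦ Q ⟧ x → Σ Tree λ S → ℙ S × ⟦ S ⟧ x
  ⊏⊏-branchCovered {Q} q x∈Q =
    let (Ds , Ds⊆ℙ , covers) = ⊏⊏-covered Q q
        i = covers _ x∈Q
    in Any.lookup i , All.lookupAny Ds⊆ℙ i

⊏⊏-disjoint : ∀ {ℙ ℚ} → ℙ ⊏⊏ ℚ → Disjoint ℙ ℚ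
⊏⊏-disjoint r T t q = ⊏⊏-notAbove r T T q t (λ _ u → u)

-- (i) ⊏⊏ is irreflexive, since a non-empty ℙ would meet itself.
⊏⊏-irreflexive : ∀ {ℙ} → IsPTF ℙ → ¬ (ℙ ⊏⊏ ℙ)
⊏⊏-irreflexive ptf r = let (T , t) = IsPTF.inhabited ptf in ⊏⊏-disjoint r T t t

-- (i) [S] ∩ [T] has empty interior in [S]: otherwise some S ∣ s ∈ ℙ would have
-- all its branches, hence all its nodes, in T ∈ ℚ.
⊏⊏-nowhereDense : EM → ∀ {ℙ ℚ} → IsPTF ℙ → ℙ ⊏⊏ ℚ →
  ∀ S T → ℙ S → ℚ T → NowhereDenseIn ⟦ S ⟧ (⟦ S ⟧ ∩ ⟦ T ⟧)
⊏⊏-nowhereDense em {ℙ} ptf r S T S∈ℙ T∈ℚ = closed-nowhereDense em T emptyInterior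
  where
  emptyInterior : ∀ s → (Σ Cantor λ x → ⟦ S ⟧ x × s ≺ x) → ¬ (∀ y → ⟦ S ⟧ y → s ≺ y → ⟦ T ⟧ y)
  emptyInterior s (x , x∈S , (k , x↾k≡s)) inside =
    ⊏⊏-notAbove r T (S ∣ s) T∈ℚ S∣s∈ℙ
      (⟦⟧⊆⇒⊆ᵀ (IsPTF.perfect ptf S∣s∈ℙ) λ y y∈S∣s →
         let (y∈S , y↾s) = ⟦∣⟧→ {S} {s} y∈S∣s in inside y y∈S (length s , y↾s))
    where
    S∣s∈ℙ : ℙ (S ∣ s)
    S∣s∈ℙ = IsPTF.restrict ptf S∈ℙ (subst S x↾k≡s (x∈S k))

-- (i) Below a tree of ℚ there is only ℚ: an element of ℙ below Q ∈ ℚ would be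
-- contained in Q.
⊏⊏-open : ∀ {ℙ ℚ} → ℙ ⊏⊏ ℚ → OpenInP (ℙ ∪ᵀ ℚ) ℚ
⊏⊏-open r Q Q∈ℚ T (inj₁ T∈ℙ) T⊆Q = ⊥-elim (⊏⊏-notAbove r Q T Q∈ℚ T∈ℙ T⊆Q)
⊏⊏-open r Q Q∈ℚ T (inj₂ T∈ℚ) _   = T∈ℚ

⊏⊏-dense : ∀ {ℙ ℚ} → ℙ ⊏⊏ ℚ → DenseInP (ℙ ∪ᵀ ℚ) ℚ
⊏⊏-dense r T (inj₁ T∈ℙ) = ⊏⊏-below r T T∈ℙ
⊏⊏-dense r T (inj₂ T∈ℚ) = T , T∈ℚ , λ _ u → u

⊆fin⋃-trans : ∀ {ℙ ℚ : TSet} → (∀ Q → ℚ Q → Q ⊆fin⋃ ℙ) →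
  ∀ Qs → All ℚ Qs → Σ (List Tree) λ Ss →
    All ℙ Ss × (∀ x → Any (λ Q → ⟦ Q ⟧ x) Qs → Any (λ S → ⟦ S ⟧ x) Ss)
⊆fin⋃-trans covered []       []             = [] , [] , λ _ ()
⊆fin⋃-trans covered (Q ∷ Qs) (Q∈ℚ ∷ Qs⊆ℚ) =
  let (Ss₁ , Ss₁⊆ℙ , cover₁) = covered Q Q∈ℚ
      (Ss₂ , Ss₂⊆ℙ , cover₂) = ⊆fin⋃-trans covered Qs Qs⊆ℚ
  in Ss₁ ++ Ss₂ , All.++⁺ Ss₁⊆ℙ Ss₂⊆ℙ ,
     λ { x (here x∈Q)  → Any.++⁺ˡ (cover₁ x x∈Q)
       ; x (there x∈Qs) → Any.++⁺ʳ Ss₁ (cover₂ x x∈Qs) }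

⊏⊏-trans : ∀ {ℙ ℚ ℝ} → ℙ ⊏⊏ ℚ → ℚ ⊏⊏ ℝ → ℙ ⊏⊏ ℝ
⊏⊏-trans {ℙ} {ℚ} {ℝ} ℙ⊏⊏ℚ ℚ⊏⊏ℝ =
  below , covered , λ R T R∈ℝ T∈ℙ → clopen R T R∈ℝ T∈ℙ , notAbove R T R∈ℝ T∈ℙ
  where
  below : ∀ T → ℙ T → ∃[ R ] (ℝ R × R ⊆ᵀ T)
  below T T∈ℙ =
    let (Q , Q∈ℚ , Q⊆T) = ⊏⊏-below ℙ⊏⊏ℚ T T∈ℙ
        (R , R∈ℝ , R⊆Q) = ⊏⊏-below ℚ⊏⊏ℝ Q Q∈ℚ
    in R , R∈ℝ , λ s s∈R → Q⊆T s (R⊆Q s s∈R)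
  covered : ∀ R → ℝ R → R ⊆fin⋃ ℙ
  covered R R∈ℝ =
    let (Qs , Qs⊆ℚ , coverQ) = ⊏⊏-covered ℚ⊏⊏ℝ R R∈ℝ
        (Ss , Ss⊆ℙ , coverS) = ⊆fin⋃-trans (⊏⊏-covered ℙ⊏⊏ℚ) Qs Qs⊆ℚ
    in Ss , Ss⊆ℙ , λ x x∈R → coverS x (coverQ x x∈R)
  -- Near each branch of R, [R] coincides with some [Q], Q ∈ ℚ, in which
  -- [T] is clopen.
  clopen : ∀ R T → ℝ R → ℙ T → ClopenIn ⟦ R ⟧ (⟦ R ⟧ ∩ ⟦ T ⟧)
  clopen R T R∈ℝ T∈ℙ = ClopenIn-local λ x x∈R →
    let (Q , Q∈ℚ , x∈Q) = ⊏⊏-branchCovered ℚ⊏⊏ℝ R∈ℝ x∈R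
    in ⟦ Q ⟧ , x∈Q ,
       Nbhd-mono (λ _ _ → proj₂) (proj₁ (⊏⊏-clopen ℚ⊏⊏ℝ R Q R∈ℝ Q∈ℚ) x x∈R (x∈R , x∈Q)) ,
       ⊏⊏-clopen ℙ⊏⊏ℚ Q T Q∈ℚ T∈ℙ
  notAbove : ∀ R T → ℝ R → ℙ T → ¬ (T ⊆ᵀ R)
  notAbove R T R∈ℝ T∈ℙ T⊆R =
    let (Q , Q∈ℚ , Q⊆T) = ⊏⊏-below ℙ⊏⊏ℚ T T∈ℙ
    in ⊏⊏-notAbove ℚ⊏⊏ℝ R Q R∈ℝ Q∈ℚ (λ s s∈Q → T⊆R s (Q⊆T s s∈Q))

⟦≐∣⟧-root : ∀ {S S₁ s} → S ≐ (S₁ ∣ s) → ∀ y → ⟦ S ⟧ y → ⟦ S₁ ⟧ y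
⟦≐∣⟧-root {S₁ = S₁} {s} S≐S₁∣s y y∈S = proj₁ (⟦∣⟧→ {S₁} {s} (⟦≐⟧ S≐S₁∣s y y∈S))

-- Two trees of one special notion meet in a clopen set: they are
-- restrictions S₁ ∣ s, T₁ ∣ t of trees that are equal or have disjoint
-- branches; in the first case [S] ∩ [T] is the cylinder of t within [S].
special-clopen : EM → ∀ {ℙ} → Special ℙ →
  ∀ S T → ℙ S → ℙ T → ClopenIn ⟦ S ⟧ (⟦ S ⟧ ∩ ⟦ T ⟧)
special-clopen em (A , disjoint , isRestriction , _) S T S∈ℙ T∈ℙ
  with isRestriction S S∈ℙ | isRestriction T T∈ℙ
... | (S₁ , s , S₁∈A , _ , S≐S₁∣s) | (T₁ , t , T₁∈A , _ , T≐T₁∣t) with em {P = S₁ ≐ T₁}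
...   | yes S₁≐T₁ = ClopenIn-cylinder (length t) t
        (λ y _ y∈S∩T → proj₂ (⟦∣⟧→ {T₁} {t} (⟦≐⟧ T≐T₁∣t y (proj₂ y∈S∩T))))
        (λ y y∈S y↾t → y∈S ,
           ⟦≐⟧ (swap T≐T₁∣t) y
             (⟦∣⟧← {T₁} {t} (⟦≐⟧ S₁≐T₁ y (⟦≐∣⟧-root S≐S₁∣s y y∈S)) y↾t))
...   | no S₁≉T₁ = ClopenIn-empty λ y y∈S y∈S∩T →
        disjoint S₁ T₁ S₁∈A T₁∈A S₁≉T₁ y
          (⟦≐∣⟧-root S≐S₁∣s y y∈S) (⟦≐∣⟧-root T≐T₁∣t y (proj₂ y∈S∩T))

-- Every tree T of a refinement ℚ of ℙ has a restriction lying inside a tree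
-- of ℙ: pick a branch x of T, a tree S ∈ ℙ containing x, and a neighbourhood
-- of x in which [T] ⊆ [S] (clause (3)).
⊏⊏-restrictionBelow : ∀ {ℙ ℚ} → IsPTF ℚ → ℙ ⊏⊏ ℚ →
  ∀ T → ℚ T → Σ Tree λ S → ℙ S × Σ Str λ s → T s × (T ∣ s) ⊆ᵀ S
⊏⊏-restrictionBelow ptf r T T∈ℚ =
  let perfT = IsPTF.perfect ptf T∈ℚ
      (x , x∈T , _) = branchThrough perfT (IsPerfect.nonempty perfT)
      (S , S∈ℙ , x∈S) = ⊏⊏-branchCovered r T∈ℚ x∈T
      (n , nearX) = proj₁ (⊏⊏-clopen r T S T∈ℚ S∈ℙ) x x∈T (x∈T , x∈S)
      T∣x↾n∈ℚ = IsPTF.restrict ptf T∈ℚ (x∈T n)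
  in S , S∈ℙ , x ↾ n , x∈T n ,
     ⟦⟧⊆⇒⊆ᵀ (IsPTF.perfect ptf T∣x↾n∈ℚ) λ y y∈T∣x↾n →
       let (y∈T , y↾x↾n) = ⟦∣⟧→ {T} {x ↾ n} y∈T∣x↾n
       in proj₂ (nearX y y∈T (subst (λ k → y ↾ k ≡ x ↾ n) (length-↾ x n) y↾x↾n))

module _ (W : WellOrder) (P : WellOrder.Carrier W → TSet) where
  open WellOrder W
  private module O = IsStrictTotalOrder isStrictTotalOrder

  below-<-notBelow : ∀ {α β μ} → α < μ → ¬ (β < μ) → α < β
  below-<-notBelow {α} {β} α<μ β≮μ with O.compare α β
  ... | tri< α<β _ _    = α<β
  ... | tri≈ _ refl _   = ⊥-elim (β≮μ α<μ)
  ... | tri> _ _ β<α    = ⊥-elim (β≮μ (O.trans β<α α<μ))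

  ⊏⊏-⋃Below-⋃From : Increasing W P →
    ∀ μ → Σ Carrier (λ α → α < μ) → ⋃Below W P μ ⊏⊏ ⋃From W P μ
  ⊏⊏-⋃Below-⋃From inc μ (α₀ , α₀<μ) = below , covered , clopenNotAbove
    where
    below : ∀ T → ⋃Below W P μ T → ∃[ Q ] (⋃From W P μ Q × Q ⊆ᵀ T)
    below T (α , α<μ , T∈Pα) =
      let (Q , Q∈Pμ , Q⊆T) = ⊏⊏-below (inc α μ α<μ) T T∈Pα
      in Q , (μ , O.irrefl refl , Q∈Pμ) , Q⊆T
    covered : ∀ Q → ⋃From W P μ Q → Q ⊆fin⋃ ⋃Below W P μ
    covered Q (β , β≮μ , Q∈Pβ) =
      let (Ss , Ss⊆Pα₀ , cover) = ⊏⊏-covered (inc α₀ β (below-<-notBelow α₀<μ β≮μ)) Q Q∈Pβ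
      in Ss , All.map (λ S∈Pα₀ → α₀ , α₀<μ , S∈Pα₀) Ss⊆Pα₀ , cover
    clopenNotAbove : ∀ Q T → ⋃From W P μ Q → ⋃Below W P μ T →
      ClopenIn ⟦ Q ⟧ (⟦ Q ⟧ ∩ ⟦ T ⟧) × ¬ (T ⊆ᵀ Q)
    clopenNotAbove Q T (β , β≮μ , Q∈Pβ) (α , α<μ , T∈Pα) =
      proj₂ (proj₂ (inc α β (below-<-notBelow α<μ β≮μ))) Q T Q∈Pβ T∈Pα

  ⋃All-isPTF : Carrier → (∀ α → IsPTF (P α)) → IsPTF (⋃All W P)
  ⋃All-isPTF α₀ ptf = record
    { inhabited   = let (T , T∈P) = IsPTF.inhabited (ptf α₀) in T , α₀ , T∈P
    ; perfect     = λ { (α , T∈Pα) → IsPTF.perfect (ptf α) T∈Pα }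
    ; restrict    = λ { (α , T∈Pα) s∈T → α , IsPTF.restrict (ptf α) T∈Pα s∈T }
    ; extensional = λ { S≐T (α , S∈Pα) → α , IsPTF.extensional (ptf α) S≐T S∈Pα }
    }

  -- (iv) Trees from different levels meet clopenly in the later one by
  -- clause (3); trees from the same special level by special-clopen.
  ⋃All-regular : EM → (∀ α → Special (P α)) → Increasing W P → Regular (⋃All W P)
  ⋃All-regular em special inc S T (α , S∈Pα) (β , T∈Pβ) with O.compare α β
  ... | tri< α<β _ _  = inj₂ (ClopenIn-∩-comm (⊏⊏-clopen (inc α β α<β) T S T∈Pβ S∈Pα))
  ... | tri> _ _ β<α  = inj₁ (⊏⊏-clopen (inc β α β<α) S T S∈Pα T∈Pβ)
  ... | tri≈ _ refl _ = inj₁ (special-clopen em (special α) S T S∈Pα T∈Pβ)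

  -- (iv) Each level is pre-dense in the union: trees of earlier levels lie
  -- above trees of level γ, and trees of later levels have restrictions
  -- below trees of level γ.
  ⋃All-preDense : (∀ α → IsPTF (P α)) → Increasing W P → ∀ γ → PreDenseInP (⋃All W P) (P γ)
  ⋃All-preDense ptf inc γ = (λ T T∈Pγ → γ , T∈Pγ) , compatible
    where
    compatible : ∀ T → ⋃All W P T → ∃[ S ] (P γ S × ∃[ R ] (⋃All W P R × R ⊆ᵀ T × R ⊆ᵀ S))
    compatible T (α , T∈Pα) with O.compare α γ
    ... | tri< α<γ _ _ =
      let (Q , Q∈Pγ , Q⊆T) = ⊏⊏-below (inc α γ α<γ) T T∈Pα
      in Q , Q∈Pγ , Q , (γ , Q∈Pγ) , Q⊆T , (λ _ u → u)
    ... | tri≈ _ refl _ = T , T∈Pα , T , (α , T∈Pα) , (λ _ u → u) , (λ _ u → u)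
    ... | tri> _ _ γ<α =
      let (S , S∈Pγ , s , s∈T , T∣s⊆S) = ⊏⊏-restrictionBelow (ptf α) (inc γ α γ<α) T T∈Pα
      in S , S∈Pγ , T ∣ s , (α , IsPTF.restrict (ptf α) T∈Pα s∈T) , (λ _ → proj₁) , T∣s⊆S

lemma9p2 : ({ℓ : Level} → ExcludedMiddle ℓ) →
  -- (i) and (ii)
  (∀ (ℙ ℚ ℝ : TSet) → IsPTF ℙ → IsPTF ℚ → IsPTF ℝ →
    (ℙ ⊏⊏ ℚ →
      (∀ S T → ℙ S → ℚ T → MeagerIn ⟦ S ⟧ (⟦ S ⟧ ∩ ⟦ T ⟧))
      × Disjoint ℙ ℚ
      × OpenInP (ℙ ∪ᵀ ℚ) ℚ
      × DenseInP (ℙ ∪ᵀ ℚ) ℚ)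
    × (ℙ ⊏⊏ ℚ → ℚ ⊏⊏ ℝ → ℙ ⊏⊏ ℝ)
    × ¬ (ℙ ⊏⊏ ℙ))
  -- (iii)
  × (∀ (W : WellOrder) (P : WellOrder.Carrier W → TSet) →
    (∀ α → IsPTF (P α)) → Increasing W P →
    ∀ μ → Σ (WellOrder.Carrier W) (λ α → WellOrder._<_ W α μ) →
    ⋃Below W P μ ⊏⊏ ⋃From W P μ)
  -- (iv)
  × (∀ (W : WellOrder) (P : WellOrder.Carrier W → TSet) →
    WellOrder.Carrier W →
    (∀ α → IsPTF (P α)) → (∀ α → Special (P α)) → Increasing W P →
    IsPTF (⋃All W P)
    × Regular (⋃All W P)
    × (∀ γ → PreDenseInP (⋃All W P) (P γ)))
lemma9p2 em =
  (λ ℙ ℚ ℝ ℙ-ptf _ _ →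
     (λ r → (λ S T S∈ℙ T∈ℚ → nowhereDense⇒meager (⊏⊏-nowhereDense em ℙ-ptf r S T S∈ℙ T∈ℚ)) ,
            ⊏⊏-disjoint r , ⊏⊏-open r , ⊏⊏-dense r) ,
     ⊏⊏-trans ,
     ⊏⊏-irreflexive ℙ-ptf) ,
  (λ W P _ inc → ⊏⊏-⋃Below-⋃From W P inc) ,
  (λ W P α₀ ptf special inc →
     ⋃All-isPTF W P α₀ ptf , ⋃All-regular W P em special inc , ⋃All-preDense W P ptf inc)
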